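{- Let $n\ge1$ and $q$ a quadratic form on $\mathbb{Q}^{n+1}$. Suppose $\mathbf{x},\mathbf{y}\in\mathbb{Q}^{n+1}$ are linearly independent, the subspace $W$ they span is not totally isotropic, and $q(\mathbf{y})=0$. Let $\mathbf{z}=\psi(\mathbf{x},\mathbf{y})=b(\mathbf{x},\mathbf{y})\mathbf{x}-q(\mathbf{x})\mathbf{y}$. Then $\mathbf{z}\ne0$, $q(\mathbf{z})=0$, and \[ \|\mathbf{y}\|\,\|\mathbf{z}\|\le2\|q\|\,\|\mathbf{x}\wedge\mathbf{y}\|^2, \] where $\|q\|=\max\{|q_\mathbb{R}(\mathbf{x})|:\mathbf{x}\in\mathbb{R}^{n+1},\|\mathbf{x}\|=1\}$.
   Context: $b(\mathbf{x},\mathbf{y})=q(\mathbf{x}+\mathbf{y})-q(\mathbf{x})-q(\mathbf{y})$; $q_\mathbb{R}$ is $q$ extended to $\mathbb{R}^{n+1}$. A subspace $W$ is totally isotropic if $b(\mathbf{u},\mathbf{v})=0$ for all $\mathbf{u},\mathbf{v}\in W$. Norms: Euclidean on $\mathbb{R}^{n+1}$ and on $\bigwedge^2\mathbb{R}^{n+1}$ (with $\mathbf{e}_i\wedge\mathbf{e}_j$, $i<j$, orthonormal). -}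

module Defs where

open import Data.Nat using (ℕ; zero; suc)
open import Data.Fin using (Fin; zero; suc)
open import Data.Fin.Properties using (_<?_)
open import Data.Rational using (ℚ; 0ℚ; _+_; _*_; _-_)
open import Data.Product using (Σ; _×_; _,_)
open import Relation.Nullary using (yes; no)
open import Relation.Binary.PropositionalEquality using (_≡_)

Vecℚ : ℕ → Set
Vecℚ m = Fin m → ℚ

Σℚ : ∀ {k} → (Fin k → ℚ) → ℚ
Σℚ {zero}  f = 0ℚ
Σℚ {suc k} f = f zero + Σℚ (λ i → f (suc i))

-- a quadratic form on ℚ^m, given by a coefficient matrix:
-- q(x) = Σ_{i,j} A i j x_i x_j  (every quadratic form arises this way)
QuadForm : ℕ → Set
QuadForm m = Fin m → Fin m → ℚ

qf : ∀ {m} → QuadForm m → Vecℚ m → ℚ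
qf A x = Σℚ (λ i → Σℚ (λ j → A i j * (x i * x j)))

_⊕_ : ∀ {m} → Vecℚ m → Vecℚ m → Vecℚ m
(u ⊕ v) i = u i + v i

_·_ : ∀ {m} → ℚ → Vecℚ m → Vecℚ m
(a · v) i = a * v i

bf : ∀ {m} → QuadForm m → Vecℚ m → Vecℚ m → ℚ
bf A x y = (qf A (x ⊕ y) - qf A x) - qf A y

IsZero : ∀ {m} → Vecℚ m → Set
IsZero v = ∀ i → v i ≡ 0ℚ

LinIndep : ∀ {m} → Vecℚ m → Vecℚ m → Set
LinIndep x y = ∀ (a c : ℚ) → IsZero ((a · x) ⊕ (c · y)) → (a ≡ 0ℚ) × (c ≡ 0ℚ)

InSpan : ∀ {m} → Vecℚ m → Vecℚ m → Vecℚ m → Set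
InSpan x y u = Σ ℚ λ a → Σ ℚ λ c → ∀ i → u i ≡ a * x i + c * y i

TotallyIsotropicSpan : ∀ {m} → QuadForm m → Vecℚ m → Vecℚ m → Set
TotallyIsotropicSpan A x y =
  ∀ u v → InSpan x y u → InSpan x y v → bf A u v ≡ 0ℚ

ψ : ∀ {m} → QuadForm m → Vecℚ m → Vecℚ m → Vecℚ m
ψ A x y i = bf A x y * x i - qf A x * y i

normSq : ∀ {m} → Vecℚ m → ℚ
normSq v = Σℚ (λ i → v i * v i)

-- squared norm of x ∧ y, with e_i ∧ e_j (i<j) orthonormal
wedgeNormSq : ∀ {m} → Vecℚ m → Vecℚ m → ℚ
wedgeNormSq x y = Σℚ (λ i → Σℚ (λ j → coeff i j))
  where
  coeff : _ → _ → ℚ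
  coeff i j with i <? j
  ... | yes _ = (x i * y j - x j * y i) * (x i * y j - x j * y i)
  ... | no  _ = 0ℚ

open Data.Rational using (1ℚ)
4ℚ : ℚ
4ℚ = (1ℚ + 1ℚ) + (1ℚ + 1ℚ)

{-# OPTIONS --safe #-}
module Submission where

-- With a = q(x) and b = b(x, y), the hypothesis q(y) = 0 gives q(s x + t y) = a s² + b s t, so
-- ψ = b x − a y is the second isotropic direction of the plane W = span(x, y); were ψ = 0,
-- independence would give a = b = 0 and q would vanish on W.  For the bound, |q| ≤ c‖·‖² says
-- that c N ∓ Q are positive semidefinite binary forms in (s, t), N being the Gram form of x, y.
-- Their discriminant conditions combine into ‖y‖²‖ψ‖² ≤ 4c²(‖x‖²‖y‖² − ⟨x,y⟩²)², and Lagrange's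
-- identity turns the bracket into ‖x ∧ y‖².  A bound with c ≤ 0 would force q = 0 on W.

open import Defs
open import Data.Nat using (ℕ; suc)
import Data.Nat
open import Data.Rational using (ℚ; 0ℚ; _*_; _≤_; ∣_∣)
open import Data.Product using (_×_)
open import Relation.Nullary using (¬_)
open import Relation.Binary.PropositionalEquality using (_≡_)

import Data.Rational.Properties as ℚ
open import Algebra.Bundles using (CommutativeRing)
open import Algebra.Properties.Semiring.Sum (CommutativeRing.semiring ℚ.+-*-commutativeRing)
  using (sum; sum-cong-≗; ∑-distrib-+; *-distribˡ-sum)
open import Data.Bool using (if_then_else_)
open import Data.Fin using (Fin; zero; suc)
open import Data.Fin.Properties using (_<?_)
open import Data.Product using (Σ-syntax; proj₁; proj₂; _,_)
open import Data.Rational using (1ℚ; _+_; _-_; -_; _<_; positive; nonNegative; nonPositive)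
open import Data.Sum using (inj₁; inj₂)
open import Function using (_∘_)
open import Level using (0ℓ)
open import Relation.Nullary using (Dec; yes; no; does; contradiction)
open import Relation.Nullary.Decidable using (dec⇒maybe)
open import Relation.Binary.PropositionalEquality
  using (_≗_; refl; sym; trans; cong; cong₂; subst; subst₂; module ≡-Reasoning)
open import Tactic.RingSolver using (solve-∀)
open import Tactic.RingSolver.Core.AlmostCommutativeRing using (AlmostCommutativeRing; fromCommutativeRing)

open ≡-Reasoning

private
  ring : AlmostCommutativeRing 0ℓ 0ℓ
  ring = fromCommutativeRing ℚ.+-*-commutativeRing (λ p → dec⇒maybe (0ℚ ℚ.≟ p))

p≤q⇒0≤q-p : ∀ {p q} → p ≤ q → 0ℚ ≤ q - p
p≤q⇒0≤q-p {p} {q} p≤q = subst (_≤ q - p) (ℚ.+-inverseʳ p) (ℚ.+-monoˡ-≤ (- p) p≤q)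

0≤q-p⇒p≤q : ∀ {p q} → 0ℚ ≤ q - p → p ≤ q
0≤q-p⇒p≤q {p} {q} 0≤q-p = subst₂ _≤_ (ℚ.+-identityˡ p) (q-p+p≡q p q) (ℚ.+-monoˡ-≤ p 0≤q-p)
  where
  q-p+p≡q : ∀ p q → q - p + p ≡ q
  q-p+p≡q = solve-∀ ring

*-nonNeg : ∀ {p q} → 0ℚ ≤ p → 0ℚ ≤ q → 0ℚ ≤ p * q
*-nonNeg {p} {q} 0≤p 0≤q =
  ℚ.nonNegative⁻¹ _ {{ℚ.nonNeg*nonNeg⇒nonNeg p {{nonNegative 0≤p}} q {{nonNegative 0≤q}}}}

-- despite its name, ℚ.nonPos*nonPos⇒nonPos concludes NonNegative
0≤p*p : ∀ p → 0ℚ ≤ p * p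
0≤p*p p with ℚ.≤-total 0ℚ p
... | inj₁ 0≤p = *-nonNeg 0≤p 0≤p
... | inj₂ p≤0 = ℚ.nonNegative⁻¹ _ {{ℚ.nonPos*nonPos⇒nonPos p {{nonPositive p≤0}} p {{nonPositive p≤0}}}}

*-cancelˡ-nonNeg : ∀ {k p} → 0ℚ < k → 0ℚ ≤ k * p → 0ℚ ≤ p
*-cancelˡ-nonNeg {k} {p} 0<k 0≤kp =
  ℚ.*-cancelˡ-≤-pos k {{positive 0<k}} (subst (_≤ k * p) (sym (ℚ.*-zeroʳ k)) 0≤kp)

p≤∣p∣ : ∀ p → p ≤ ∣ p ∣
p≤∣p∣ p with ℚ.∣p∣≡p∨∣p∣≡-p p
... | inj₁ ∣p∣≡p = ℚ.≤-reflexive (sym ∣p∣≡p)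
... | inj₂ ∣p∣≡-p = ℚ.≤-trans p≤0 (ℚ.0≤∣p∣ p)
  where
  p≤0 : p ≤ 0ℚ
  p≤0 = 0≤q-p⇒p≤q (subst (0ℚ ≤_) (trans ∣p∣≡-p (sym (ℚ.+-identityˡ (- p)))) (ℚ.0≤∣p∣ p))

-p≤∣p∣ : ∀ p → - p ≤ ∣ p ∣
-p≤∣p∣ p = subst (- p ≤_) (ℚ.∣-p∣≡∣p∣ p) (p≤∣p∣ (- p))

Σℚ≡sum : ∀ {k} (f : Fin k → ℚ) → Σℚ f ≡ sum f
Σℚ≡sum {0} f = refl
Σℚ≡sum {suc k}         f = cong (f zero +_) (Σℚ≡sum (f ∘ suc))

Σℚ-cong : ∀ {k} {f g : Fin k → ℚ} → f ≗ g → Σℚ f ≡ Σℚ g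
Σℚ-cong {f = f} {g} f≗g = begin
  Σℚ f   ≡⟨ Σℚ≡sum f ⟩
  sum f  ≡⟨ sum-cong-≗ f≗g ⟩
  sum g  ≡⟨ Σℚ≡sum g ⟨
  Σℚ g   ∎

Σℚ-linear : ∀ {k} s t {f g h : Fin k → ℚ} → (∀ i → h i ≡ s * f i + t * g i) →
            Σℚ h ≡ s * Σℚ f + t * Σℚ g
Σℚ-linear s t {f} {g} {h} h≗sf+tg = begin
  Σℚ h                                       ≡⟨ Σℚ-cong h≗sf+tg ⟩
  Σℚ (λ i → s * f i + t * g i)               ≡⟨ Σℚ≡sum (λ i → s * f i + t * g i) ⟩
  sum (λ i → s * f i + t * g i)              ≡⟨ ∑-distrib-+ (λ i → s * f i) (λ i → t * g i) ⟩
  sum (λ i → s * f i) + sum (λ i → t * g i)  ≡⟨ cong₂ _+_ (*-distribˡ-sum s f) (*-distribˡ-sum t g) ⟨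
  s * sum f + t * sum g                      ≡⟨ cong₂ (λ p q → s * p + t * q) (Σℚ≡sum f) (Σℚ≡sum g) ⟨
  s * Σℚ f + t * Σℚ g                        ∎

bilinear : ∀ {m} → QuadForm m → Vecℚ m → Vecℚ m → ℚ
bilinear A u v = Σℚ λ i → Σℚ λ j → A i j * (u i * v j)

dot : ∀ {m} → Vecℚ m → Vecℚ m → ℚ
dot u v = Σℚ λ i → u i * v i

binaryForm : ℚ → ℚ → ℚ → ℚ → ℚ → ℚ
binaryForm α β γ s t = s * s * α + s * t * β + t * t * γ

record IsBilinear {m} (B : Vecℚ m → Vecℚ m → ℚ) : Set where
  field
    linearˡ : ∀ s t x y v → B ((s · x) ⊕ (t · y)) v ≡ s * B x v + t * B y v
    linearʳ : ∀ s t u x y → B u ((s · x) ⊕ (t · y)) ≡ s * B u x + t * B u y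

  diagonal : ∀ s t x y → B ((s · x) ⊕ (t · y)) ((s · x) ⊕ (t · y)) ≡
             binaryForm (B x x) (B x y + B y x) (B y y) s t
  diagonal s t x y = begin
    B w w                                                       ≡⟨ linearˡ s t x y w ⟩
    s * B x w + t * B y w                                       ≡⟨ cong₂ (λ p q → s * p + t * q)
                                                                     (linearʳ s t x x y) (linearʳ s t y x y) ⟩
    s * (s * B x x + t * B x y) + t * (s * B y x + t * B y y)   ≡⟨ collect s t (B x x) (B x y) (B y x) (B y y) ⟩
    binaryForm (B x x) (B x y + B y x) (B y y) s t              ∎
    where
    w : Vecℚ m
    w = (s · x) ⊕ (t · y)
    collect : ∀ s t a b c d → s * (s * a + t * b) + t * (s * c + t * d) ≡ s * s * a + s * t * (b + c) + t * t * d
    collect = solve-∀ ring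

bilinear-isBilinear : ∀ {m} (A : QuadForm m) → IsBilinear (bilinear A)
bilinear-isBilinear A = record
  { linearˡ = λ s t x y v → Σℚ-linear s t λ i → Σℚ-linear s t λ j → left (A i j) s t (x i) (y i) (v j)
  ; linearʳ = λ s t u x y → Σℚ-linear s t λ i → Σℚ-linear s t λ j → right (A i j) s t (u i) (x j) (y j)
  }
  where
  left : ∀ a s t x y v → a * ((s * x + t * y) * v) ≡ s * (a * (x * v)) + t * (a * (y * v))
  left = solve-∀ ring
  right : ∀ a s t u x y → a * (u * (s * x + t * y)) ≡ s * (a * (u * x)) + t * (a * (u * y))
  right = solve-∀ ring

dot-isBilinear : ∀ {m} → IsBilinear (dot {m})
dot-isBilinear = record
  { linearˡ = λ s t x y v → Σℚ-linear s t λ i → left s t (x i) (y i) (v i)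
  ; linearʳ = λ s t u x y → Σℚ-linear s t λ i → right s t (u i) (x i) (y i)
  }
  where
  left : ∀ s t x y v → (s * x + t * y) * v ≡ s * (x * v) + t * (y * v)
  left = solve-∀ ring
  right : ∀ s t u x y → u * (s * x + t * y) ≡ s * (u * x) + t * (u * y)
  right = solve-∀ ring

dot-comm : ∀ {m} (u v : Vecℚ m) → dot u v ≡ dot v u
dot-comm u v = Σℚ-cong λ i → ℚ.*-comm (u i) (v i)

qf-cong : ∀ {m} (A : QuadForm m) {u v} → u ≗ v → qf A u ≡ qf A v
qf-cong A u≗v = Σℚ-cong λ i → Σℚ-cong λ j → cong₂ (λ p q → A i j * (p * q)) (u≗v i) (u≗v j)

normSq-cong : ∀ {m} {u v : Vecℚ m} → u ≗ v → normSq u ≡ normSq v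
normSq-cong u≗v = Σℚ-cong λ i → cong₂ _*_ (u≗v i) (u≗v i)

normSq-nonNeg : ∀ {k} (v : Vecℚ k) → 0ℚ ≤ normSq v
normSq-nonNeg {0} v = ℚ.≤-refl
normSq-nonNeg {suc k}         v = ℚ.+-mono-≤ (0≤p*p (v zero)) (normSq-nonNeg (v ∘ suc))

bf≡bilinear+bilinear : ∀ {m} (A : QuadForm m) x y → bf A x y ≡ bilinear A x y + bilinear A y x
bf≡bilinear+bilinear A x y = begin
  (qf A (x ⊕ y) - qf A x) - qf A y                             ≡⟨ cong (λ p → (p - qf A x) - qf A y) q[x+y] ⟩
  (binaryForm (qf A x) β (qf A y) 1ℚ 1ℚ - qf A x) - qf A y     ≡⟨ cancel (qf A x) β (qf A y) ⟩
  β                                                            ∎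
  where
  β : ℚ
  β = bilinear A x y + bilinear A y x
  x+y≗1x+1y : x ⊕ y ≗ (1ℚ · x) ⊕ (1ℚ · y)
  x+y≗1x+1y i = sym (cong₂ _+_ (ℚ.*-identityˡ (x i)) (ℚ.*-identityˡ (y i)))
  q[x+y] : qf A (x ⊕ y) ≡ binaryForm (qf A x) β (qf A y) 1ℚ 1ℚ
  q[x+y] = trans (qf-cong A x+y≗1x+1y) (IsBilinear.diagonal (bilinear-isBilinear A) 1ℚ 1ℚ x y)
  cancel : ∀ a b c → (1ℚ * 1ℚ * a + 1ℚ * 1ℚ * b + 1ℚ * 1ℚ * c - a) - c ≡ b
  cancel = solve-∀ ring

qf-lincomb : ∀ {m} (A : QuadForm m) s t x y →
             qf A ((s · x) ⊕ (t · y)) ≡ binaryForm (qf A x) (bf A x y) (qf A y) s t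
qf-lincomb A s t x y =
  trans (IsBilinear.diagonal (bilinear-isBilinear A) s t x y)
        (cong (λ β → binaryForm (qf A x) β (qf A y) s t) (sym (bf≡bilinear+bilinear A x y)))

normSq-lincomb : ∀ {m} s t (x y : Vecℚ m) →
                 normSq ((s · x) ⊕ (t · y)) ≡ binaryForm (normSq x) (dot x y + dot x y) (normSq y) s t
normSq-lincomb s t x y =
  trans (IsBilinear.diagonal dot-isBilinear s t x y)
        (cong (λ g → binaryForm (normSq x) (dot x y + g) (normSq y) s t) (dot-comm y x))

-- Isotropic vectors in the span of x and y

InSpan-⊕ : ∀ {m} {x y u v : Vecℚ m} → InSpan x y u → InSpan x y v → InSpan x y (u ⊕ v)
InSpan-⊕ {x = x} {y} (s , t , u≗) (s′ , t′ , v≗) =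
  s + s′ , t + t′ , λ i → trans (cong₂ _+_ (u≗ i) (v≗ i)) (regroup s t s′ t′ (x i) (y i))
  where
  regroup : ∀ s t s′ t′ a b → (s * a + t * b) + (s′ * a + t′ * b) ≡ (s + s′) * a + (t + t′) * b
  regroup = solve-∀ ring

vanishing⇒totallyIsotropic : ∀ {m} (A : QuadForm m) {x y} →
                             (∀ u → InSpan x y u → qf A u ≡ 0ℚ) → TotallyIsotropicSpan A x y
vanishing⇒totallyIsotropic A q≡0 u v u∈W v∈W = begin
  (qf A (u ⊕ v) - qf A u) - qf A v  ≡⟨ cong₂ (λ p r → (p - r) - qf A v)
                                             (q≡0 (u ⊕ v) (InSpan-⊕ u∈W v∈W)) (q≡0 u u∈W) ⟩
  (0ℚ - 0ℚ) - qf A v                ≡⟨ cong (λ r → (0ℚ - 0ℚ) - r) (q≡0 v v∈W) ⟩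
  0ℚ                                ∎

isotropicBasis⇒totallyIsotropic : ∀ {m} (A : QuadForm m) {x y} →
  qf A x ≡ 0ℚ → bf A x y ≡ 0ℚ → qf A y ≡ 0ℚ → TotallyIsotropicSpan A x y
isotropicBasis⇒totallyIsotropic A {x} {y} qx≡0 bxy≡0 qy≡0 = vanishing⇒totallyIsotropic A q≡0
  where
  zero-form : ∀ s t → s * s * 0ℚ + s * t * 0ℚ + t * t * 0ℚ ≡ 0ℚ
  zero-form = solve-∀ ring
  q≡0 : ∀ u → InSpan x y u → qf A u ≡ 0ℚ
  q≡0 u (s , t , u≗) = begin
    qf A u                                        ≡⟨ qf-cong A u≗ ⟩
    qf A ((s · x) ⊕ (t · y))                      ≡⟨ qf-lincomb A s t x y ⟩
    binaryForm (qf A x) (bf A x y) (qf A y) s t   ≡⟨ cong₂ (λ α β → binaryForm α β (qf A y) s t) qx≡0 bxy≡0 ⟩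
    binaryForm 0ℚ 0ℚ (qf A y) s t                 ≡⟨ cong (λ γ → binaryForm 0ℚ 0ℚ γ s t) qy≡0 ⟩
    binaryForm 0ℚ 0ℚ 0ℚ s t                       ≡⟨ zero-form s t ⟩
    0ℚ                                            ∎

nonPos-bound⇒qf≡0 : ∀ {m} (A : QuadForm m) {c} → c ≤ 0ℚ → (∀ v → ∣ qf A v ∣ ≤ c * normSq v) →
                    ∀ v → qf A v ≡ 0ℚ
nonPos-bound⇒qf≡0 A {c} c≤0 bounded v =
  ℚ.∣p∣≡0⇒p≡0 (qf A v) (ℚ.≤-antisym (ℚ.≤-trans (bounded v) c*normSq≤0) (ℚ.0≤∣p∣ (qf A v)))
  where
  c*normSq≤0 : c * normSq v ≤ 0ℚ
  c*normSq≤0 = ℚ.nonPositive⁻¹ _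
    {{ℚ.nonPos*nonNeg⇒nonPos c {{nonPositive c≤0}} (normSq v) {{nonNegative (normSq-nonNeg v)}}}}

ψ≗lincomb : ∀ {m} (A : QuadForm m) x y → ψ A x y ≗ (bf A x y · x) ⊕ ((- qf A x) · y)
ψ≗lincomb A x y i = cong (bf A x y * x i +_) (ℚ.neg-distribˡ-* (qf A x) (y i))

qf-ψ : ∀ {m} (A : QuadForm m) x y → qf A y ≡ 0ℚ → qf A (ψ A x y) ≡ 0ℚ
qf-ψ A x y qy≡0 = begin
  qf A (ψ A x y)                     ≡⟨ qf-cong A (ψ≗lincomb A x y) ⟩
  qf A ((b · x) ⊕ ((- a) · y))       ≡⟨ qf-lincomb A b (- a) x y ⟩
  binaryForm a b (qf A y) b (- a)    ≡⟨ cong (λ γ → binaryForm a b γ b (- a)) qy≡0 ⟩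
  binaryForm a b 0ℚ b (- a)          ≡⟨ isotropic a b ⟩
  0ℚ                                 ∎
  where
  a b : ℚ
  a = qf A x
  b = bf A x y
  isotropic : ∀ a b → b * b * a + b * (- a) * b + (- a) * (- a) * 0ℚ ≡ 0ℚ
  isotropic = solve-∀ ring

ψ-nonzero : ∀ {m} (A : QuadForm m) {x y} → LinIndep x y → ¬ TotallyIsotropicSpan A x y →
            qf A y ≡ 0ℚ → ¬ IsZero (ψ A x y)
ψ-nonzero A {x} {y} independent anisotropic qy≡0 ψ≡0 =
  anisotropic (isotropicBasis⇒totallyIsotropic A (ℚ.neg-injective -qx≡0) bxy≡0 qy≡0)
  where
  coefficients≡0 : bf A x y ≡ 0ℚ × - qf A x ≡ 0ℚ
  coefficients≡0 = independent (bf A x y) (- qf A x) (λ i → trans (sym (ψ≗lincomb A x y i)) (ψ≡0 i))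
  bxy≡0 : bf A x y ≡ 0ℚ
  bxy≡0 = proj₁ coefficients≡0
  -qx≡0 : - qf A x ≡ 0ℚ
  -qx≡0 = proj₂ coefficients≡0

-- Positive semidefinite binary forms

nonNeg-binaryForm⇒β²≤4αγ : ∀ α β γ → (∀ s t → 0ℚ ≤ binaryForm α β γ s t) → β * β ≤ 4ℚ * α * γ
nonNeg-binaryForm⇒β²≤4αγ α β γ nonNeg with 0ℚ ℚ.<? γ | 0ℚ ℚ.<? α
... | yes 0<γ | _ =
  0≤q-p⇒p≤q (*-cancelˡ-nonNeg 0<γ (subst (0ℚ ≤_) (at-γ α β γ) (nonNeg (γ + γ) (- β))))
  where
  at-γ : ∀ α β γ → (γ + γ) * (γ + γ) * α + (γ + γ) * (- β) * β + (- β) * (- β) * γ ≡ γ * (4ℚ * α * γ - β * β)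
  at-γ = solve-∀ ring
... | no _ | yes 0<α =
  0≤q-p⇒p≤q (*-cancelˡ-nonNeg 0<α (subst (0ℚ ≤_) (at-α α β γ) (nonNeg (- β) (α + α))))
  where
  at-α : ∀ α β γ → (- β) * (- β) * α + (- β) * (α + α) * β + (α + α) * (α + α) * γ ≡ α * (4ℚ * α * γ - β * β)
  at-α = solve-∀ ring
... | no 0≮γ | no 0≮α =
  0≤q-p⇒p≤q (subst (0ℚ ≤_) (sym (split α β γ))
    (ℚ.+-mono-≤ (nonNeg 1ℚ (- β))
      (ℚ.+-mono-≤ (ℚ.+-mono-≤ (*-nonNeg (ℚ.nonNegative⁻¹ 4ℚ) (*-nonNeg 0≤-α 0≤-γ)) 0≤-α)
                  (*-nonNeg (0≤p*p β) 0≤-γ))))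
  where
  0≤-α : 0ℚ ≤ - α
  0≤-α = ℚ.neg-antimono-≤ (ℚ.≮⇒≥ 0≮α)
  0≤-γ : 0ℚ ≤ - γ
  0≤-γ = ℚ.neg-antimono-≤ (ℚ.≮⇒≥ 0≮γ)
  split : ∀ α β γ → 4ℚ * α * γ - β * β ≡
          (1ℚ * 1ℚ * α + 1ℚ * (- β) * β + (- β) * (- β) * γ) + ((4ℚ * ((- α) * (- γ)) + (- α)) + β * β * (- γ))
  split = solve-∀ ring

D²≤4T[T+e] : ∀ T D {e} → 0ℚ ≤ e → 0ℚ ≤ T - D → 0ℚ ≤ T + D → D * D ≤ 4ℚ * T * (T + e)
D²≤4T[T+e] T D {e} 0≤e 0≤T-D 0≤T+D =
  0≤q-p⇒p≤q (subst (0ℚ ≤_) (sym (split T D e))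
    (ℚ.+-mono-≤ (*-nonNeg 0≤T-D 0≤T+D)
                (*-nonNeg 0≤T (ℚ.+-mono-≤ (ℚ.+-mono-≤ (ℚ.+-mono-≤ 0≤T 0≤T) 0≤T)
                                          (*-nonNeg (ℚ.nonNegative⁻¹ 4ℚ) 0≤e)))))
  where
  double : ∀ T D → (T - D) + (T + D) ≡ (1ℚ + 1ℚ) * T
  double = solve-∀ ring
  0≤T : 0ℚ ≤ T
  0≤T = *-cancelˡ-nonNeg (ℚ.positive⁻¹ (1ℚ + 1ℚ)) (subst (0ℚ ≤_) (double T D) (ℚ.+-mono-≤ 0≤T-D 0≤T+D))
  split : ∀ T D e → 4ℚ * T * (T + e) - D * D ≡ (T - D) * (T + D) + T * (T + T + T + 4ℚ * e)
  split = solve-∀ ring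

∣Q∣≤cN⇒cN∓Q-nonNeg : ∀ {a b e c X B Y} → (∀ s t → ∣ binaryForm a b e s t ∣ ≤ c * binaryForm X B Y s t) →
  (∀ s t → 0ℚ ≤ binaryForm (c * X - a) (c * B - b) (c * Y - e) s t) ×
  (∀ s t → 0ℚ ≤ binaryForm (c * X + a) (c * B + b) (c * Y + e) s t)
∣Q∣≤cN⇒cN∓Q-nonNeg {a} {b} {e} {c} {X} {B} {Y} ∣Q∣≤cN =
  (λ s t → subst (0ℚ ≤_) (cN-Q a b e c X B Y s t) (p≤q⇒0≤q-p (ℚ.≤-trans (p≤∣p∣ _) (∣Q∣≤cN s t)))) ,
  (λ s t → subst (0ℚ ≤_) (cN+Q a b e c X B Y s t) (p≤q⇒0≤q-p (ℚ.≤-trans (-p≤∣p∣ _) (∣Q∣≤cN s t))))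
  where
  cN-Q : ∀ a b e c X B Y s t → c * (s * s * X + s * t * B + t * t * Y) - (s * s * a + s * t * b + t * t * e)
         ≡ s * s * (c * X - a) + s * t * (c * B - b) + t * t * (c * Y - e)
  cN-Q = solve-∀ ring
  cN+Q : ∀ a b e c X B Y s t → c * (s * s * X + s * t * B + t * t * Y) - (- (s * s * a + s * t * b + t * t * e))
         ≡ s * s * (c * X + a) + s * t * (c * B + b) + t * t * (c * Y + e)
  cN+Q = solve-∀ ring

-- The discriminant conditions of the semidefinite forms cN ∓ Q read T ∓ D ≥ 0, and the claim
-- multiplied by 16c² is D² ≤ 4T(T + b²).
binaryForm-bound : ∀ {a b c X G Y} → 0ℚ < c →
  (∀ s t → ∣ binaryForm a b 0ℚ s t ∣ ≤ c * binaryForm X (G + G) Y s t) →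
  Y * binaryForm X (G + G) Y b (- a) ≤ 4ℚ * (c * c) * ((X * Y - G * G) * (X * Y - G * G))
binaryForm-bound {a} {b} {c} {X} {G} {Y} 0<c ∣Q∣≤cN =
  0≤q-p⇒p≤q (*-cancelˡ-nonNeg 0<16c²
    (subst (0ℚ ≤_) (rescale a b c X G Y) (p≤q⇒0≤q-p (D²≤4T[T+e] T D (0≤p*p b) 0≤T-D 0≤T+D))))
  where
  T D : ℚ
  T = 4ℚ * (c * c) * (X * Y - G * G) - b * b
  D = 4ℚ * c * (a * Y - b * G)
  discriminant∓ : ∀ a b c X G Y → 4ℚ * (c * X - a) * (c * Y - 0ℚ) - (c * (G + G) - b) * (c * (G + G) - b)
                  ≡ (4ℚ * (c * c) * (X * Y - G * G) - b * b) - 4ℚ * c * (a * Y - b * G)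
  discriminant∓ = solve-∀ ring
  discriminant± : ∀ a b c X G Y → 4ℚ * (c * X + a) * (c * Y + 0ℚ) - (c * (G + G) + b) * (c * (G + G) + b)
                  ≡ (4ℚ * (c * c) * (X * Y - G * G) - b * b) + 4ℚ * c * (a * Y - b * G)
  discriminant± = solve-∀ ring
  0≤T-D : 0ℚ ≤ T - D
  0≤T-D = subst (0ℚ ≤_) (discriminant∓ a b c X G Y)
            (p≤q⇒0≤q-p (nonNeg-binaryForm⇒β²≤4αγ _ _ _ (proj₁ (∣Q∣≤cN⇒cN∓Q-nonNeg {c = c} ∣Q∣≤cN))))
  0≤T+D : 0ℚ ≤ T + D
  0≤T+D = subst (0ℚ ≤_) (discriminant± a b c X G Y)
            (p≤q⇒0≤q-p (nonNeg-binaryForm⇒β²≤4αγ _ _ _ (proj₂ (∣Q∣≤cN⇒cN∓Q-nonNeg {c = c} ∣Q∣≤cN))))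
  0<16c² : 0ℚ < 4ℚ * 4ℚ * (c * c)
  0<16c² = ℚ.positive⁻¹ _
    {{ℚ.pos*pos⇒pos (4ℚ * 4ℚ) (c * c) {{ℚ.pos*pos⇒pos c {{positive 0<c}} c {{positive 0<c}}}}}}
  rescale : ∀ a b c X G Y →
    4ℚ * (4ℚ * (c * c) * (X * Y - G * G) - b * b) * ((4ℚ * (c * c) * (X * Y - G * G) - b * b) + b * b)
      - (4ℚ * c * (a * Y - b * G)) * (4ℚ * c * (a * Y - b * G))
    ≡ 4ℚ * 4ℚ * (c * c) * (4ℚ * (c * c) * ((X * Y - G * G) * (X * Y - G * G))
                           - Y * (b * b * X + b * (- a) * (G + G) + (- a) * (- a) * Y))
  rescale = solve-∀ ring

-- Lagrange's identity

Σ< : ∀ {k} → (Fin k → Fin k → ℚ) → ℚ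
Σ< f = Σℚ λ i → Σℚ λ j → if does (i <? j) then f i j else 0ℚ

Σ<-suc : ∀ {k} (f : Fin (suc k) → Fin (suc k) → ℚ) →
         Σ< f ≡ Σℚ (λ j → f zero (suc j)) + Σ< (λ i j → f (suc i) (suc j))
Σ<-suc f = cong₂ _+_ (ℚ.+-identityˡ (Σℚ λ j → f zero (suc j)))
  (Σℚ-cong λ i → ℚ.+-identityˡ (Σℚ λ j → if does (i <? j) then f (suc i) (suc j) else 0ℚ))

wedgeTerm : ∀ {m} → Vecℚ m → Vecℚ m → Fin m → Fin m → ℚ
wedgeTerm x y i j = (x i * y j - x j * y i) * (x i * y j - x j * y i)

Σ<-wedgeTerm : ∀ {k} (x y : Vecℚ k) → Σ< (wedgeTerm x y) ≡ normSq x * normSq y - dot x y * dot x y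
Σ<-wedgeTerm {0} x y = refl
Σ<-wedgeTerm {suc k} x y = begin
  Σ< (wedgeTerm x y)
    ≡⟨ Σ<-suc (wedgeTerm x y) ⟩
  Σℚ (λ j → wedgeTerm x y zero (suc j)) + Σ< (wedgeTerm x′ y′)
    ≡⟨ cong₂ _+_ first-row (Σ<-wedgeTerm x′ y′) ⟩
  binaryForm (normSq y′) (G + G) (normSq x′) x₀ (- y₀) + (normSq x′ * normSq y′ - G * G)
    ≡⟨ regroup x₀ y₀ (normSq x′) (normSq y′) G ⟩
  (x₀ * x₀ + normSq x′) * (y₀ * y₀ + normSq y′) - (x₀ * y₀ + G) * (x₀ * y₀ + G)
    ∎
  where
  x′ y′ : Vecℚ k
  x′ = x ∘ suc
  y′ = y ∘ suc
  x₀ y₀ G : ℚ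
  x₀ = x zero
  y₀ = y zero
  G = dot x′ y′
  as-lincomb : ∀ a b c d → (a * b - c * d) * (a * b - c * d) ≡ (a * b + (- d) * c) * (a * b + (- d) * c)
  as-lincomb = solve-∀ ring
  first-row : Σℚ (λ j → wedgeTerm x y zero (suc j)) ≡ binaryForm (normSq y′) (G + G) (normSq x′) x₀ (- y₀)
  first-row = begin
    Σℚ (λ j → wedgeTerm x y zero (suc j))
      ≡⟨ Σℚ-cong (λ j → as-lincomb x₀ (y′ j) (x′ j) y₀) ⟩
    normSq ((x₀ · y′) ⊕ ((- y₀) · x′))
      ≡⟨ normSq-lincomb x₀ (- y₀) y′ x′ ⟩
    binaryForm (normSq y′) (dot y′ x′ + dot y′ x′) (normSq x′) x₀ (- y₀)
      ≡⟨ cong (λ g → binaryForm (normSq y′) (g + g) (normSq x′) x₀ (- y₀)) (dot-comm y′ x′) ⟩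
    binaryForm (normSq y′) (G + G) (normSq x′) x₀ (- y₀)
      ∎
  regroup : ∀ x₀ y₀ X Y G → (x₀ * x₀ * Y + x₀ * (- y₀) * (G + G) + (- y₀) * (- y₀) * X) + (X * Y - G * G)
            ≡ (x₀ * x₀ + X) * (y₀ * y₀ + Y) - (x₀ * y₀ + G) * (x₀ * y₀ + G)
  regroup = solve-∀ ring

-- The coefficient function of wedgeNormSq is a with-function in Defs and cannot be named, so it is
-- obtained by unification.  select matches on the decision itself, which keeps i <? j visible to
-- `with`; under if does, normalisation would remove it.
select : ∀ {P : Set} → Dec P → ℚ → ℚ
select (yes _) q = q
select (no _)  _ = 0ℚ

select≡if : ∀ {P : Set} (d : Dec P) q → select d q ≡ (if does d then q else 0ℚ)
select≡if (yes _) q = refl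
select≡if (no _)  q = refl

wedgeCoefficients : ∀ {m} (x y : Vecℚ m) →
                    Σ[ C ∈ (Fin m → Fin m → ℚ) ] wedgeNormSq x y ≡ Σℚ (λ i → Σℚ (C i))
wedgeCoefficients x y = _ , refl

wedgeCoefficient≡ : ∀ {m} (x y : Vecℚ m) i j →
                    proj₁ (wedgeCoefficients x y) i j ≡ select (i <? j) (wedgeTerm x y i j)
wedgeCoefficient≡ x y i j with i <? j
... | yes _ = refl
... | no _  = refl

wedgeNormSq-lagrange : ∀ {m} (x y : Vecℚ m) → wedgeNormSq x y ≡ normSq x * normSq y - dot x y * dot x y
wedgeNormSq-lagrange x y =
  trans (Σℚ-cong λ i → Σℚ-cong λ j →
           trans (wedgeCoefficient≡ x y i j) (select≡if (i <? j) (wedgeTerm x y i j)))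
        (Σ<-wedgeTerm x y)

ψ-bound : ∀ {m} (A : QuadForm m) {x y c} → qf A y ≡ 0ℚ → 0ℚ < c → (∀ v → ∣ qf A v ∣ ≤ c * normSq v) →
          normSq y * normSq (ψ A x y) ≤ 4ℚ * (c * c) * (wedgeNormSq x y * wedgeNormSq x y)
ψ-bound A {x} {y} {c} qy≡0 0<c bounded =
  subst₂ _≤_ (cong (normSq y *_) (sym normSq-ψ))
             (cong (λ w → 4ℚ * (c * c) * (w * w)) (sym (wedgeNormSq-lagrange x y)))
             (binaryForm-bound {G = dot x y} 0<c bounded-on-span)
  where
  normSq-ψ : normSq (ψ A x y) ≡ binaryForm (normSq x) (dot x y + dot x y) (normSq y) (bf A x y) (- qf A x)
  normSq-ψ = trans (normSq-cong (ψ≗lincomb A x y)) (normSq-lincomb (bf A x y) (- qf A x) x y)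
  bounded-on-span : ∀ s t → ∣ binaryForm (qf A x) (bf A x y) 0ℚ s t ∣ ≤
                            c * binaryForm (normSq x) (dot x y + dot x y) (normSq y) s t
  bounded-on-span s t =
    subst₂ (λ q n → ∣ q ∣ ≤ c * n)
           (trans (qf-lincomb A s t x y) (cong (λ γ → binaryForm (qf A x) (bf A x y) γ s t) qy≡0))
           (normSq-lincomb s t x y)
           (bounded ((s · x) ⊕ (t · y)))

lemma9p1 : (n : ℕ) → 1 Data.Nat.≤ n → (A : QuadForm (suc n)) → (x y : Vecℚ (suc n))
    → LinIndep x y → ¬ TotallyIsotropicSpan A x y → qf A y ≡ 0ℚ
    → ¬ IsZero (ψ A x y) × qf A (ψ A x y) ≡ 0ℚ
      × (∀ (c : ℚ) → (∀ (v : Vecℚ (suc n)) → ∣ qf A v ∣ ≤ c * normSq v)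
         → normSq y * normSq (ψ A x y) ≤ (4ℚ * (c * c)) * (wedgeNormSq x y * wedgeNormSq x y))
lemma9p1 n _ A x y independent anisotropic qy≡0 =
  ψ-nonzero A independent anisotropic qy≡0 , qf-ψ A x y qy≡0 , bound
  where
  bound : ∀ (c : ℚ) → (∀ (v : Vecℚ (suc n)) → ∣ qf A v ∣ ≤ c * normSq v)
          → normSq y * normSq (ψ A x y) ≤ (4ℚ * (c * c)) * (wedgeNormSq x y * wedgeNormSq x y)
  bound c bounded with 0ℚ ℚ.<? c
  ... | yes 0<c = ψ-bound A qy≡0 0<c bounded
  ... | no 0≮c  = contradiction
    (vanishing⇒totallyIsotropic A λ u _ → nonPos-bound⇒qf≡0 A (ℚ.≮⇒≥ 0≮c) bounded u) anisotropic
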